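{- For all sufficiently large $n \in \mathbb{N}$, there exists a graph $G$ on $n$ vertices with $\delta(G) \ge n/2 + 1$ and a proper $\big(n/8 + 2^{10}(n\log n)^{2/3}\big)$-bounded edge-colouring of $G$ such that $G$ contains no rainbow Hamilton cycle.
   Context: An edge-colouring is proper if any two edges sharing an endpoint receive different colours; it is $b$-bounded if every colour is assigned to at most $b$ edges. A Hamilton cycle is rainbow if all its edges receive distinct colours. $\delta(G)$ is the minimum degree of $G$. -}

module Defs where

open import Data.Nat as ℕ using (ℕ; zero; suc; _<ᵇ_; _≡ᵇ_; _^_)
open import Data.Integer using (+_)
open import Data.Rational as ℚ using (ℚ; 0ℚ; 1ℚ)
open import Data.Fin using (Fin; toℕ)
open import Data.List using (List; map; allFin; concatMap)
open import Data.Nat.ListAction using (sum)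
open import Data.Bool using (Bool; true; false; if_then_else_; _∧_)
open import Data.Product using (_×_; Σ; _,_)
open import Data.Sum using (_⊎_)
open import Relation.Binary.PropositionalEquality using (_≡_; _≢_)
open import Function.Definitions using (Bijective)

record Graph (n : ℕ) : Set where
  field
    adj    : Fin n → Fin n → Bool
    sym    : ∀ u v → adj u v ≡ adj v u
    irrefl : ∀ u → adj u u ≡ false
open Graph public

degree : ∀ {n} → Graph n → Fin n → ℕ
degree {n} G u = sum (map (λ v → if adj G u v then 1 else 0) (allFin n))

MinDegreeAtLeastHalfPlusOne : ∀ {n} → Graph n → Set
MinDegreeAtLeastHalfPlusOne {n} G = ∀ u → n ℕ.+ 2 ℕ.≤ 2 ℕ.* degree G u

-- Edge-colourings (colours are natural numbers; only values on edges matter)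

Colouring : ℕ → Set
Colouring n = Fin n → Fin n → ℕ

IsEdgeColouring : ∀ {n} → Graph n → Colouring n → Set
IsEdgeColouring G c = ∀ u v → adj G u v ≡ true → c u v ≡ c v u

Proper : ∀ {n} → Graph n → Colouring n → Set
Proper G c = ∀ u v w → adj G u v ≡ true → adj G u w ≡ true → v ≢ w → c u v ≢ c u w

colourClassSize : ∀ {n} → Graph n → Colouring n → ℕ → ℕ
colourClassSize {n} G c k =
  sum (concatMap (λ u → map (λ v →
         if (toℕ u <ᵇ toℕ v) ∧ adj G u v ∧ (c u v ≡ᵇ k) then 1 else 0)
       (allFin n)) (allFin n))

-- Exponential / logarithm without reals.
-- expSum q k = Σ_{j<k} q^j / j!   (partial sums of e^q)

expTerm : ℚ → ℕ → ℚ
expTerm q zero    = 1ℚ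
expTerm q (suc j) = expTerm q j ℚ.* q ℚ.* (+ 1 ℚ./ suc j)

expSum : ℚ → ℕ → ℚ
expSum q zero    = 0ℚ
expSum q (suc k) = expSum q k ℚ.+ expTerm q k

-- For q ≥ 0:  e^q ≤ N  (the partial sums increase to e^q)
ExpAtMost : ℚ → ℕ → Set
ExpAtMost q N = ∀ k → expSum q k ℚ.≤ (+ N ℚ./ 1)

-- m ≤ n/8 + 2^10 (n ln n)^{2/3}   (natural logarithm), for n ≥ 1.
-- With d = max(0, 8m − n) this is  d ≤ 2^13 (n ln n)^{2/3},
-- i.e.  sqrt(d^3 / 2^39) ≤ n ln n, i.e. every rational s = a/(b+1) ≥ 0 with
-- s^2 ≤ d^3 / 2^39 satisfies s ≤ n ln n, i.e. e^s ≤ n^n.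
WithinBound : ℕ → ℕ → Set
WithinBound n m =
  ∀ (a b : ℕ) →
    a ^ 2 ℕ.* 2 ^ 39 ℕ.≤ ((8 ℕ.* m) ℕ.∸ n) ^ 3 ℕ.* (suc b) ^ 2 →
    ExpAtMost (+ a ℚ./ suc b) (n ^ n)

BoundedColouring : ∀ {n} → Graph n → Colouring n → Set
BoundedColouring {n} G c = ∀ k → WithinBound n (colourClassSize G c k)

CycSucc : ∀ {n} → Fin n → Fin n → Set
CycSucc {n} i j = (suc (toℕ i) ≡ toℕ j) ⊎ ((suc (toℕ i) ≡ n) × (toℕ j ≡ 0))

record HamiltonCycle {n} (G : Graph n) : Set where
  field
    σ         : Fin n → Fin n
    bijective : Bijective _≡_ _≡_ σ
    edges     : ∀ i j → CycSucc i j → adj G (σ i) (σ j) ≡ true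
open HamiltonCycle public

Rainbow : ∀ {n} {G : Graph n} → Colouring n → HamiltonCycle G → Set
Rainbow c H = ∀ i j i' j' → CycSucc i j → CycSucc i' j' →
  c (σ H i) (σ H j) ≡ c (σ H i') (σ H j') → i ≡ i'

-- Split the vertices {0, …, n - 1} into A = X ∪ Y, with X = [0, h), Y = [h, 2h), h = w t and t odd,
-- and B = [2h, n) of size b = n - 2h.  B is independent and completely joined to A, and x ∈ X, y ∈ Y
-- are adjacent iff (x + y) mod h < r, so vertices of B have degree 2h and vertices of A degree b + r.
-- An edge xy inside A gets colour (x + 2y) mod t, which is proper as t is odd; an edge pq with p ∈ A,
-- q ∈ B gets t + 4 (p + q) + (q - 2h) mod 4.  A Hamilton cycle spends exactly 2b of its edges at the
-- independent set B, so n - 2b > t of them lie inside A, where only t colours occur: it is not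
-- rainbow.  A colour class holds at most w r inner edges (one per block x / t and offset (x + y) mod h)
-- and at most b / 4 ≤ w r edges between A and B.  Taking w ≈ (n / 8)^(1/3), t (4w - 1) just above n
-- and 2r ≈ 4wt - n + 2 makes all degrees at least n/2 + 1 and w r ≤ n/8 + 2^10 (n log n)^(2/3).

module Submission where

open import Defs hiding (sym)
open import Data.Bool using (Bool; true; false; if_then_else_; not; _∧_)
import Data.Bool as Bool
open import Data.Bool.Properties using (not-injective; T-∧; T-≡)
open import Data.Fin as Fin using (Fin; toℕ; fromℕ<; join; splitAt)
open import Data.Fin.Properties using (toℕ-injective; toℕ<n; toℕ-fromℕ<; fromℕ<-injective; injective⇒≤; splitAt-join)
open import Data.Integer as ℤ using (+_)
import Data.Integer.Properties as ℤ
open import Data.List using (List; []; _∷_; _++_; map; length; lookup; filter; concatMap; allFin; cartesianProduct)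
open import Data.List.Membership.Propositional using (_∈_)
open import Data.List.Membership.Propositional.Properties using (∈-lookup; ∈-filter⁻)
open import Data.List.Properties using (map-++; map-∘; length-tabulate)
import Data.List.Relation.Unary.All as All
open import Data.List.Relation.Unary.AllPairs using (_∷_)
open import Data.List.Relation.Unary.Unique.Propositional using (Unique)
open import Data.List.Relation.Unary.Unique.Propositional.Properties using (filter⁺; allFin⁺; cartesianProduct⁺)
open import Data.Nat
open import Data.Nat.DivMod
open import Data.Nat.Divisibility using (n∣m*n)
open import Data.Nat.ListAction using (sum)
open import Data.Nat.ListAction.Properties using (sum-++)
open import Data.Nat.Properties
open import Data.Nat.Solver using (module +-*-Solver)
open import Data.Product using (Σ; ∃; _×_; _,_; proj₁; proj₂; uncurry)
open import Data.Rational using (ℚ; 0ℚ; 1ℚ)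
import Data.Rational as ℚ
import Data.Rational.Properties as ℚ
open import Data.Rational.Unnormalised as ℚᵘ using (mkℚᵘ; *≤*)
import Data.Rational.Unnormalised.Properties as ℚᵘ
open import Data.Sum using (_⊎_; inj₁; inj₂)
import Data.Sum as Sum
open import Data.Sum.Properties using (inj₁-injective; inj₂-injective)
open import Function using (_∘_; id)
open import Function.Bundles using (Equivalence; mk⇔)
open import Relation.Binary.PropositionalEquality
open import Relation.Nullary using (¬_; Dec; yes; no; does)
open import Relation.Nullary.Decidable using (_×-dec_; _⊎-dec_; ¬?; dec-false; does-⇔)
open import Relation.Nullary.Negation using (contradiction)

open +-*-Solver using (solve; _:+_; _:*_; _:^_; con; _:=_)
open Equivalence using (to; from)

count : {A : Set} → (A → Bool) → List A → ℕ
count p xs = sum (map (λ x → if p x then 1 else 0) xs)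

count-complement : {A : Set} (p : A → Bool) (xs : List A) → count p xs + count (not ∘ p) xs ≡ length xs
count-complement p []       = refl
count-complement p (x ∷ xs) with p x
... | true  = cong suc (count-complement p xs)
... | false = trans (+-suc (count p xs) _) (cong suc (count-complement p xs))

count≡length-filter : {A : Set} (p : A → Bool) (xs : List A) →
                      count p xs ≡ length (filter (λ x → p x Bool.≟ true) xs)
count≡length-filter p []       = refl
count≡length-filter p (x ∷ xs) with p x
... | true  = cong suc (count≡length-filter p xs)
... | false = count≡length-filter p xs

Unique⇒lookup-injective : {A : Set} {xs : List A} → Unique xs → ∀ {i j} → lookup xs i ≡ lookup xs j → i ≡ j
Unique⇒lookup-injective (_ ∷ _)      {Fin.zero}  {Fin.zero}  _  = refl
Unique⇒lookup-injective (x∉xs ∷ _)   {Fin.zero}  {Fin.suc j} eq = contradiction eq (All.lookup x∉xs (∈-lookup j))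
Unique⇒lookup-injective (x∉xs ∷ _)   {Fin.suc i} {Fin.zero}  eq = contradiction (sym eq) (All.lookup x∉xs (∈-lookup i))
Unique⇒lookup-injective (_ ∷ unique) {Fin.suc i} {Fin.suc j} eq = cong Fin.suc (Unique⇒lookup-injective unique eq)

injection⇒count≤ : {A : Set} (p : A → Bool) {xs : List A} → Unique xs → (M : ℕ) (code : A → ℕ) →
  (∀ {x} → x ∈ xs → p x ≡ true → code x < M) →
  (∀ {x y} → x ∈ xs → y ∈ xs → p x ≡ true → p y ≡ true → code x ≡ code y → x ≡ y) →
  count p xs ≤ M
injection⇒count≤ p {xs} unique M code code<M code-injective =
  ≤-trans (≤-reflexive (count≡length-filter p xs)) (injective⇒≤ f-injective)
  where
  p? = λ x → p x Bool.≟ true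
  ys = filter p? xs

  member : ∀ i → lookup ys i ∈ xs × p (lookup ys i) ≡ true
  member i = ∈-filter⁻ p? (∈-lookup i)

  f : Fin (length ys) → Fin M
  f i = fromℕ< (code<M (proj₁ (member i)) (proj₂ (member i)))

  f-injective : ∀ {i j} → f i ≡ f j → i ≡ j
  f-injective {i} {j} eq = Unique⇒lookup-injective (filter⁺ p? unique)
    (code-injective (proj₁ (member i)) (proj₁ (member j)) (proj₂ (member i)) (proj₂ (member j))
      (fromℕ<-injective _ _ _ _ eq))

sum-concatMap-map : {A B : Set} (f : A → B → ℕ) (xs : List A) (ys : List B) →
                    sum (concatMap (λ x → map (f x) ys) xs) ≡ sum (map (uncurry f) (cartesianProduct xs ys))
sum-concatMap-map f []       ys = refl
sum-concatMap-map f (x ∷ xs) ys = begin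
  sum (map (f x) ys ++ concatMap (λ x → map (f x) ys) xs)
    ≡⟨ sum-++ (map (f x) ys) _ ⟩
  sum (map (f x) ys) + sum (concatMap (λ x → map (f x) ys) xs)
    ≡⟨ cong₂ _+_ (cong sum (map-∘ ys)) (sum-concatMap-map f xs ys) ⟩
  sum (map (uncurry f) (map (x ,_) ys)) + sum (map (uncurry f) (cartesianProduct xs ys))
    ≡⟨ sum-++ (map (uncurry f) (map (x ,_) ys)) _ ⟨
  sum (map (uncurry f) (map (x ,_) ys) ++ map (uncurry f) (cartesianProduct xs ys))
    ≡⟨ cong sum (map-++ (uncurry f) (map (x ,_) ys) (cartesianProduct xs ys)) ⟨
  sum (map (uncurry f) (cartesianProduct (x ∷ xs) ys)) ∎
  where open ≡-Reasoning

module _ {t : ℕ} .{{_ : NonZero t}} where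

  %-cong-+ˡ : ∀ c {x y} → x % t ≡ y % t → (c + x) % t ≡ (c + y) % t
  %-cong-+ˡ c {x} {y} eq = begin
    (c + x) % t           ≡⟨ %-distribˡ-+ c x t ⟩
    (c % t + x % t) % t   ≡⟨ cong (λ z → (c % t + z) % t) eq ⟩
    (c % t + y % t) % t   ≡⟨ %-distribˡ-+ c y t ⟨
    (c + y) % t           ∎
    where open ≡-Reasoning

  %-cong-+ʳ : ∀ c {x y} → x % t ≡ y % t → (x + c) % t ≡ (y + c) % t
  %-cong-+ʳ c {x} {y} eq = trans (cong (_% t) (+-comm x c)) (trans (%-cong-+ˡ c eq) (cong (_% t) (+-comm c y)))

  -- adding c * pred t turns the common summand c into the multiple c * t
  %-cancel-+ˡ : ∀ c {x y} → (c + x) % t ≡ (c + y) % t → x % t ≡ y % t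
  %-cancel-+ˡ c {x} {y} eq = begin
    x % t                        ≡⟨ [m+kn]%n≡m%n x c t ⟨
    (x + c * t) % t              ≡⟨ cong (_% t) (shift x) ⟩
    (c * pred t + (c + x)) % t   ≡⟨ %-cong-+ˡ (c * pred t) eq ⟩
    (c * pred t + (c + y)) % t   ≡⟨ cong (_% t) (shift y) ⟨
    (y + c * t) % t              ≡⟨ [m+kn]%n≡m%n y c t ⟩
    y % t                        ∎
    where
    open ≡-Reasoning
    shift : ∀ z → z + c * t ≡ c * pred t + (c + z)
    shift z = begin
      z + c * t              ≡⟨ cong (λ s → z + c * s) (suc-pred t) ⟨
      z + c * suc (pred t)   ≡⟨ solve 3 (λ z c p → z :+ c :* (con 1 :+ p) := c :* p :+ (c :+ z)) refl z c (pred t) ⟩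
      c * pred t + (c + z)   ∎

  %-injective-< : ∀ {x y} → x < t → y < t → x % t ≡ y % t → x ≡ y
  %-injective-< {x} {y} x<t y<t eq = trans (sym (m<n⇒m%n≡m x<t)) (trans eq (m<n⇒m%n≡m y<t))

  /-%-injective : ∀ {x y} → x / t ≡ y / t → x % t ≡ y % t → x ≡ y
  /-%-injective {x} {y} eq/ eq% = begin
    x                     ≡⟨ m≡m%n+[m/n]*n x t ⟩
    x % t + (x / t) * t   ≡⟨ cong₂ (λ m q → m + q * t) eq% eq/ ⟩
    y % t + (y / t) * t   ≡⟨ m≡m%n+[m/n]*n y t ⟨
    y                     ∎
    where open ≡-Reasoning

*-+-injective : ∀ r {x x' d d'} → d < r → d' < r → x * r + d ≡ x' * r + d' → x ≡ x' × d ≡ d'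
*-+-injective r {x} {x'} {d} {d'} d<r d'<r eq = x≡x' , d≡d'
  where
  instance
    r≢0 : NonZero r
    r≢0 = >-nonZero (≤-<-trans z≤n d<r)
  eq' : d + x * r ≡ d' + x' * r
  eq' = trans (+-comm d _) (trans eq (+-comm _ d'))
  d≡d' : d ≡ d'
  d≡d' = %-injective-< d<r d'<r (begin
    d % r              ≡⟨ [m+kn]%n≡m%n d x r ⟨
    (d + x * r) % r    ≡⟨ cong (_% r) eq' ⟩
    (d' + x' * r) % r  ≡⟨ [m+kn]%n≡m%n d' x' r ⟩
    d' % r             ∎)
    where open ≡-Reasoning
  x≡x' : x ≡ x'
  x≡x' = *-cancelʳ-≡ x x' r (+-cancelˡ-≡ d _ _ (trans eq' (cong (_+ x' * r) (sym d≡d'))))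

-- u + 1 is an inverse of 2 modulo 2u + 1
%-cancel-double : ∀ u {x y} → (x + x) % suc (u + u) ≡ (y + y) % suc (u + u) → x % suc (u + u) ≡ y % suc (u + u)
%-cancel-double u {x} {y} eq = begin
  x % t                                ≡⟨ [m+kn]%n≡m%n x x t ⟨
  (x + x * t) % t                      ≡⟨ cong (_% t) (halve x) ⟩
  (suc u * (x + x)) % t                ≡⟨ %-distribˡ-* (suc u) (x + x) t ⟩
  ((suc u % t) * ((x + x) % t)) % t    ≡⟨ cong (λ z → ((suc u % t) * z) % t) eq ⟩
  ((suc u % t) * ((y + y) % t)) % t    ≡⟨ %-distribˡ-* (suc u) (y + y) t ⟨
  (suc u * (y + y)) % t                ≡⟨ cong (_% t) (halve y) ⟨
  (y + y * t) % t                      ≡⟨ [m+kn]%n≡m%n y y t ⟩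
  y % t                                ∎
  where
  open ≡-Reasoning
  t = suc (u + u)
  halve : ∀ z → z + z * t ≡ suc u * (z + z)
  halve z = solve 2 (λ z u → z :+ z :* (con 1 :+ (u :+ u)) := (con 1 :+ u) :* (z :+ z)) refl z u

≢⇒≡-below2 : ∀ {x y z} → x < 2 → y < 2 → z < 2 → x ≢ z → y ≢ z → x ≡ y
≢⇒≡-below2 (s≤s z≤n)       (s≤s z≤n)       _               _   _   = refl
≢⇒≡-below2 (s≤s (s≤s z≤n)) (s≤s (s≤s z≤n)) _               _   _   = refl
≢⇒≡-below2 (s≤s z≤n)       (s≤s (s≤s z≤n)) (s≤s z≤n)       x≢z _   = contradiction refl x≢z
≢⇒≡-below2 (s≤s z≤n)       (s≤s (s≤s z≤n)) (s≤s (s≤s z≤n)) _   y≢z = contradiction refl y≢z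
≢⇒≡-below2 (s≤s (s≤s z≤n)) (s≤s z≤n)       (s≤s z≤n)       _   y≢z = contradiction refl y≢z
≢⇒≡-below2 (s≤s (s≤s z≤n)) (s≤s z≤n)       (s≤s (s≤s z≤n)) x≢z _   = contradiction refl x≢z

nonNeighbourCode⇒degree≥ : ∀ {n} (G : Graph n) (v : Fin n) (M : ℕ) (code : Fin n → ℕ) →
  (∀ {w} → adj G v w ≡ false → code w < M) →
  (∀ {w w'} → adj G v w ≡ false → adj G v w' ≡ false → code w ≡ code w' → w ≡ w') →
  n ∸ M ≤ degree G v
nonNeighbourCode⇒degree≥ {n} G v M code code<M code-injective = begin
  n ∸ M                                      ≤⟨ ∸-monoʳ-≤ n nonDegree≤M ⟩
  n ∸ nonDegree                              ≡⟨ cong (_∸ nonDegree) degrees ⟨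
  degree G v + nonDegree ∸ nonDegree         ≡⟨ m+n∸n≡m (degree G v) nonDegree ⟩
  degree G v                                 ∎
  where
  open ≤-Reasoning
  nonDegree = count (not ∘ adj G v) (allFin n)
  degrees : degree G v + nonDegree ≡ n
  degrees = trans (count-complement (adj G v) (allFin n)) (length-tabulate id)
  nonDegree≤M : nonDegree ≤ M
  nonDegree≤M = injection⇒count≤ (not ∘ adj G v) (allFin⁺ n) M code
    (λ _ v≁w → code<M (not-injective v≁w))
    (λ _ _ v≁w v≁w' → code-injective (not-injective v≁w) (not-injective v≁w'))

ColourClassEdge : ∀ {n} → Graph n → Colouring n → ℕ → Fin n → Fin n → Set
ColourClassEdge G c k u v = toℕ u < toℕ v × adj G u v ≡ true × c u v ≡ k

classCode⇒colourClassSize≤ : ∀ {n} (G : Graph n) (c : Colouring n) (k M : ℕ) (code : Fin n → Fin n → ℕ) →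
  (∀ {u v} → ColourClassEdge G c k u v → code u v < M) →
  (∀ {u v u' v'} → ColourClassEdge G c k u v → ColourClassEdge G c k u' v' →
     code u v ≡ code u' v' → u ≡ u' × v ≡ v') →
  colourClassSize G c k ≤ M
classCode⇒colourClassSize≤ {n} G c k M code code<M code-injective = begin
  colourClassSize G c k
    ≡⟨ sum-concatMap-map (λ u v → if inClass? u v then 1 else 0) (allFin n) (allFin n) ⟩
  count (uncurry inClass?) (cartesianProduct (allFin n) (allFin n))
    ≤⟨ injection⇒count≤ (uncurry inClass?) (cartesianProduct⁺ (allFin⁺ n) (allFin⁺ n)) M (uncurry code)
         (λ _ e → code<M (inClass e))
         (λ _ _ e e' eq → ×-≡ (code-injective (inClass e) (inClass e') eq)) ⟩
  M ∎
  where
  open ≤-Reasoning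
  inClass? : Fin n → Fin n → Bool
  inClass? u v = (toℕ u <ᵇ toℕ v) ∧ adj G u v ∧ (c u v ≡ᵇ k)
  inClass : ∀ {u v} → inClass? u v ≡ true → ColourClassEdge G c k u v
  inClass eq with to T-∧ (from T-≡ eq)
  ... | u<v , rest with to T-∧ rest
  ...   | uv , ck = <ᵇ⇒< _ _ u<v , to T-≡ uv , ≡ᵇ⇒≡ _ _ ck
  ×-≡ : ∀ {u v u' v' : Fin n} → u ≡ u' × v ≡ v' → (u , v) ≡ (u' , v')
  ×-≡ (refl , refl) = refl

join-injective : ∀ m k {x y : Fin m ⊎ Fin k} → join m k x ≡ join m k y → x ≡ y
join-injective m k {x} {y} eq = trans (sym (splitAt-join m k x)) (trans (cong (splitAt m) eq) (splitAt-join m k y))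

map₂-injective : ∀ {A B C : Set} {f : B → C} → (∀ {x y} → f x ≡ f y → x ≡ y) →
                 ∀ {x y : A ⊎ B} → Sum.map₂ f x ≡ Sum.map₂ f y → x ≡ y
map₂-injective f-injective {inj₁ x} {inj₁ y} refl = refl
map₂-injective f-injective {inj₂ x} {inj₂ y} eq   = cong inj₂ (f-injective (inj₂-injective eq))

module _ {n : ℕ} (n>0 : 0 < n) where

  cyclicSuc : Fin n → Fin n
  cyclicSuc i with suc (toℕ i) <? n
  ... | yes i+1<n = fromℕ< i+1<n
  ... | no _      = fromℕ< n>0

  CycSucc-cyclicSuc : ∀ i → CycSucc i (cyclicSuc i)
  CycSucc-cyclicSuc i with suc (toℕ i) <? n
  ... | yes i+1<n = inj₁ (sym (toℕ-fromℕ< i+1<n))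
  ... | no i+1≮n  = inj₂ (≤-antisym (toℕ<n i) (≮⇒≥ i+1≮n) , toℕ-fromℕ< n>0)

CycSucc-injectiveˡ : ∀ {n} {i i' j : Fin n} → CycSucc i j → CycSucc i' j → i ≡ i'
CycSucc-injectiveˡ (inj₁ e)         (inj₁ e')         = toℕ-injective (suc-injective (trans e (sym e')))
CycSucc-injectiveˡ (inj₂ (e , _))   (inj₂ (e' , _))   = toℕ-injective (suc-injective (trans e (sym e')))
CycSucc-injectiveˡ (inj₁ e)         (inj₂ (_ , j≡0))  with () ← trans e j≡0
CycSucc-injectiveˡ (inj₂ (_ , j≡0)) (inj₁ e)          with () ← trans e j≡0

-- Each vertex of the independent set {v | a ≤ v} lies on two edges of a Hamilton cycle, so at
-- least n − 2 (n ∸ a) of its edges stay inside {v | v < a}, where only t colours occur.  For a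
-- rainbow cycle, coding an edge by its first endpoint in the independent set, else by its second,
-- else by its colour, is injective.
noRainbowHamiltonCycle : ∀ {n} (G : Graph n) (c : Colouring n) (a t : ℕ) →
  (∀ {u v} → a ≤ toℕ u → a ≤ toℕ v → adj G u v ≡ false) →
  (∀ {u v} → toℕ u < a → toℕ v < a → adj G u v ≡ true → c u v < t) →
  (n ∸ a) + (n ∸ a) + t < n →
  (H : HamiltonCycle G) → ¬ Rainbow c H
noRainbowHamiltonCycle {n} G c a t independent colour<t 2b+t<n H rainbow =
  <⇒≱ 2b+t<n (≤-trans (injective⇒≤ {f = encode} encode-injective) (≤-reflexive (sym (+-assoc b b t))))
  where
  b = n ∸ a
  n>0 = ≤-<-trans z≤n 2b+t<n
  next = cyclicSuc n>0
  CycSucc-next = CycSucc-cyclicSuc n>0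

  first second : Fin n → ℕ
  first i  = toℕ (σ H i)
  second i = toℕ (σ H (next i))

  tail< : ∀ {x : Fin n} → a ≤ toℕ x → toℕ x ∸ a < b
  tail< {x} a≤x = ∸-monoˡ-< (toℕ<n x) a≤x

  tail-injective : ∀ {x y : Fin n} → a ≤ toℕ x → a ≤ toℕ y → toℕ x ∸ a ≡ toℕ y ∸ a → x ≡ y
  tail-injective a≤x a≤y eq = toℕ-injective (∸-cancelʳ-≡ a≤x a≤y eq)

  edgeCode : ∀ i → Dec (a ≤ first i) → Dec (a ≤ second i) → Fin b ⊎ Fin b ⊎ Fin t
  edgeCode i (yes a≤u) _         = inj₁ (fromℕ< (tail< a≤u))
  edgeCode i (no _)    (yes a≤v) = inj₂ (inj₁ (fromℕ< (tail< a≤v)))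
  edgeCode i (no u≱a)  (no v≱a)  =
    inj₂ (inj₂ (fromℕ< (colour<t (≰⇒> u≱a) (≰⇒> v≱a) (edges H i (next i) (CycSucc-next i)))))

  edgeCode-injective : ∀ i j di di' dj dj' → edgeCode i di di' ≡ edgeCode j dj dj' → i ≡ j
  edgeCode-injective i j (yes a≤u) _ (yes a≤u') _ eq =
    proj₁ (bijective H) (tail-injective a≤u a≤u' (fromℕ<-injective _ _ _ _ (inj₁-injective eq)))
  edgeCode-injective i j (no _) (yes a≤v) (no _) (yes a≤v') eq =
    CycSucc-injectiveˡ (CycSucc-next i) (subst (CycSucc j) (sym next≡) (CycSucc-next j))
    where
    next≡ : next i ≡ next j
    next≡ = proj₁ (bijective H) (tail-injective a≤v a≤v' (fromℕ<-injective _ _ _ _ (inj₁-injective (inj₂-injective eq))))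
  edgeCode-injective i j (no _) (no _) (no _) (no _) eq =
    rainbow i (next i) j (next j) (CycSucc-next i) (CycSucc-next j) (fromℕ<-injective _ _ _ _ (inj₂-injective (inj₂-injective eq)))
  edgeCode-injective i j (yes _) _       (no _)  (yes _) ()
  edgeCode-injective i j (yes _) _       (no _)  (no _)  ()
  edgeCode-injective i j (no _)  (yes _) (yes _) _       ()
  edgeCode-injective i j (no _)  (yes _) (no _)  (no _)  ()
  edgeCode-injective i j (no _)  (no _)  (yes _) _       ()
  edgeCode-injective i j (no _)  (no _)  (no _)  (yes _) ()

  encode : Fin n → Fin (b + (b + t))
  encode i = join b (b + t) (Sum.map₂ (join b t) (edgeCode i (a ≤? first i) (a ≤? second i)))

  encode-injective : ∀ {i j} → encode i ≡ encode j → i ≡ j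
  encode-injective {i} {j} eq = edgeCode-injective i j (a ≤? first i) (a ≤? second i) (a ≤? first j) (a ≤? second j)
    (map₂-injective (join-injective b t) (join-injective b (b + t) eq))

frac : ℕ → ℕ → ℚ
frac x y = + x ℚ./ suc y

⟦_⟧ : ℕ → ℚ
⟦ m ⟧ = frac m 0

toℚᵘ-frac : ∀ x y → ℚ.toℚᵘ (frac x y) ℚᵘ.≃ mkℚᵘ (+ x) y
toℚᵘ-frac x y = ℚ.toℚᵘ-fromℚᵘ (mkℚᵘ (+ x) y)

frac-mono : ∀ x y x' y' → x * suc y' ≤ x' * suc y → frac x y ℚ.≤ frac x' y'
frac-mono x y x' y' le = ℚ.toℚᵘ-cancel-≤
  (ℚᵘ.≤-respˡ-≃ (ℚᵘ.≃-sym (toℚᵘ-frac x y)) (ℚᵘ.≤-respʳ-≃ (ℚᵘ.≃-sym (toℚᵘ-frac x' y'))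
    (*≤* (subst₂ ℤ._≤_ (ℤ.pos-* x (suc y')) (ℤ.pos-* x' (suc y)) (ℤ.+≤+ le)))))

frac-* : ∀ x y x' y' → frac x y ℚ.* frac x' y' ≡ frac (x * x') (y' + y * suc y')
frac-* x y x' y' = ℚ.toℚᵘ-injective (ℚᵘ.≃-trans (ℚ.toℚᵘ-homo-* (frac x y) (frac x' y'))
  (ℚᵘ.≃-trans (ℚᵘ.*-cong (toℚᵘ-frac x y) (toℚᵘ-frac x' y'))
  (ℚᵘ.≃-trans (ℚᵘ.≃-reflexive (cong (λ z → mkℚᵘ z (y' + y * suc y')) (sym (ℤ.pos-* x x'))))
    (ℚᵘ.≃-sym (toℚᵘ-frac _ _)))))

⟦⟧-* : ∀ m k → ⟦ m ⟧ ℚ.* ⟦ k ⟧ ≡ ⟦ m * k ⟧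
⟦⟧-* m k = frac-* m 0 k 0

⟦⟧-+ : ∀ m k → ⟦ m ⟧ ℚ.+ ⟦ k ⟧ ≡ ⟦ m + k ⟧
⟦⟧-+ m k = ℚ.toℚᵘ-injective (ℚᵘ.≃-trans (ℚ.toℚᵘ-homo-+ ⟦ m ⟧ ⟦ k ⟧)
  (ℚᵘ.≃-trans (ℚᵘ.+-cong (toℚᵘ-frac m 0) (toℚᵘ-frac k 0))
  (ℚᵘ.≃-trans (ℚᵘ.≃-reflexive (cong (λ z → mkℚᵘ z 0) numerator)) (ℚᵘ.≃-sym (toℚᵘ-frac _ _)))))
  where
  numerator : + m ℤ.* + 1 ℤ.+ + k ℤ.* + 1 ≡ + (m + k)
  numerator = cong₂ ℤ._+_ (ℤ.*-identityʳ (+ m)) (ℤ.*-identityʳ (+ k))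

⟦⟧-mono : ∀ {m k} → m ≤ k → ⟦ m ⟧ ℚ.≤ ⟦ k ⟧
⟦⟧-mono {m} {k} le = frac-mono m 0 k 0 (*-monoˡ-≤ 1 le)

frac-nonNeg : ∀ x y → 0ℚ ℚ.≤ frac x y
frac-nonNeg x y = frac-mono 0 0 x y z≤n

*-mono-≤-nonNeg : ∀ {p p' q q'} → 0ℚ ℚ.≤ p → 0ℚ ℚ.≤ q → p ℚ.≤ p' → q ℚ.≤ q' → p ℚ.* q ℚ.≤ p' ℚ.* q'
*-mono-≤-nonNeg {p} {p'} {q} {q'} 0≤p 0≤q p≤p' q≤q' =
  ℚ.≤-trans (ℚ.*-monoʳ-≤-nonNeg q {{ℚ.nonNegative 0≤q}} p≤p')
            (ℚ.*-monoˡ-≤-nonNeg p' {{ℚ.nonNegative (ℚ.≤-trans 0≤p p≤p')}} q≤q')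

*-nonNeg : ∀ {p q} → 0ℚ ℚ.≤ p → 0ℚ ℚ.≤ q → 0ℚ ℚ.≤ p ℚ.* q
*-nonNeg 0≤p 0≤q = ℚ.≤-trans (ℚ.≤-reflexive (sym (ℚ.*-zeroˡ 0ℚ))) (*-mono-≤-nonNeg ℚ.≤-refl ℚ.≤-refl 0≤p 0≤q)

module _ (q : ℚ) (Q : ℕ) (0≤q : 0ℚ ℚ.≤ q) (q≤Q : q ℚ.≤ ⟦ Q ⟧) where
  open ℚ.≤-Reasoning

  expTerm-nonNeg : ∀ j → 0ℚ ℚ.≤ expTerm q j
  expTerm-nonNeg zero    = frac-nonNeg 1 0
  expTerm-nonNeg (suc j) = *-nonNeg (*-nonNeg (expTerm-nonNeg j) 0≤q) (frac-nonNeg 1 j)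

  expTerm≤pow : ∀ j → expTerm q j ℚ.≤ ⟦ Q ^ j ⟧
  expTerm≤pow zero    = ℚ.≤-refl
  expTerm≤pow (suc j) = begin
    expTerm q j ℚ.* q ℚ.* frac 1 j
      ≤⟨ *-mono-≤-nonNeg (*-nonNeg (expTerm-nonNeg j) 0≤q) (frac-nonNeg 1 j)
           (*-mono-≤-nonNeg (expTerm-nonNeg j) 0≤q (expTerm≤pow j) q≤Q) (frac-mono 1 j 1 0 (s≤s z≤n)) ⟩
    ⟦ Q ^ j ⟧ ℚ.* ⟦ Q ⟧ ℚ.* 1ℚ   ≡⟨ ℚ.*-identityʳ _ ⟩
    ⟦ Q ^ j ⟧ ℚ.* ⟦ Q ⟧          ≡⟨ ⟦⟧-* (Q ^ j) Q ⟩
    ⟦ Q ^ j * Q ⟧                ≡⟨ cong ⟦_⟧ (*-comm (Q ^ j) Q) ⟩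
    ⟦ Q ^ suc j ⟧                ∎

  -- from j = 2Q on, the ratio q / (j + 1) of consecutive terms is at most 1/2
  expTerm-halves : ∀ j → 2 * Q ≤ j → expTerm q (suc j) ℚ.* ⟦ 2 ⟧ ℚ.≤ expTerm q j
  expTerm-halves j 2Q≤j = begin
    expTerm q j ℚ.* q ℚ.* frac 1 j ℚ.* ⟦ 2 ⟧      ≡⟨ ℚ.*-assoc (expTerm q j ℚ.* q) (frac 1 j) ⟦ 2 ⟧ ⟩
    expTerm q j ℚ.* q ℚ.* (frac 1 j ℚ.* ⟦ 2 ⟧)    ≡⟨ ℚ.*-assoc (expTerm q j) q (frac 1 j ℚ.* ⟦ 2 ⟧) ⟩
    expTerm q j ℚ.* (q ℚ.* (frac 1 j ℚ.* ⟦ 2 ⟧))  ≤⟨ ℚ.*-monoˡ-≤-nonNeg (expTerm q j) {{ℚ.nonNegative (expTerm-nonNeg j)}} ratio≤1 ⟩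
    expTerm q j ℚ.* 1ℚ                            ≡⟨ ℚ.*-identityʳ (expTerm q j) ⟩
    expTerm q j                                   ∎
    where
    ratio≤1 : q ℚ.* (frac 1 j ℚ.* ⟦ 2 ⟧) ℚ.≤ 1ℚ
    ratio≤1 = begin
      q ℚ.* (frac 1 j ℚ.* ⟦ 2 ⟧)
        ≤⟨ ℚ.*-monoʳ-≤-nonNeg (frac 1 j ℚ.* ⟦ 2 ⟧) {{ℚ.nonNegative (*-nonNeg (frac-nonNeg 1 j) (frac-nonNeg 2 0))}} q≤Q ⟩
      ⟦ Q ⟧ ℚ.* (frac 1 j ℚ.* ⟦ 2 ⟧)   ≡⟨ cong (λ z → ⟦ Q ⟧ ℚ.* z) (ℚ.*-comm (frac 1 j) ⟦ 2 ⟧) ⟩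
      ⟦ Q ⟧ ℚ.* (⟦ 2 ⟧ ℚ.* frac 1 j)   ≡⟨ ℚ.*-assoc ⟦ Q ⟧ ⟦ 2 ⟧ (frac 1 j) ⟨
      ⟦ Q ⟧ ℚ.* ⟦ 2 ⟧ ℚ.* frac 1 j     ≡⟨ cong (ℚ._* frac 1 j) (⟦⟧-* Q 2) ⟩
      ⟦ Q * 2 ⟧ ℚ.* frac 1 j           ≡⟨ frac-* (Q * 2) 0 1 j ⟩
      frac (Q * 2 * 1) (j + 0)         ≤⟨ frac-mono (Q * 2 * 1) (j + 0) 1 0 (subst₂ _≤_ (sym 2Q≡) (sym j+1≡) (m≤n⇒m≤1+n 2Q≤j)) ⟩
      1ℚ                               ∎
      where
      2Q≡ : Q * 2 * 1 * 1 ≡ 2 * Q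
      2Q≡ = solve 1 (λ Q → Q :* con 2 :* con 1 :* con 1 := con 2 :* Q) refl Q
      j+1≡ : 1 * suc (j + 0) ≡ suc j
      j+1≡ = cong suc (trans (+-identityʳ (j + 0)) (+-identityʳ j))

  module _ (1≤Q : 1 ≤ Q) where
    private
      K V : ℕ
      K = 2 * Q
      V = Q ^ K

    expTerm≤ : ∀ {j} → j ≤ K → expTerm q j ℚ.≤ ⟦ V ⟧
    expTerm≤ {j} j≤K = ℚ.≤-trans (expTerm≤pow j) (⟦⟧-mono (^-monoʳ-≤ Q {{>-nonZero 1≤Q}} j≤K))

    expSum≤-initial : ∀ k → k ≤ K → expSum q k ℚ.≤ ⟦ k * V ⟧
    expSum≤-initial zero    _   = ℚ.≤-refl
    expSum≤-initial (suc k) k<K = begin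
      expSum q k ℚ.+ expTerm q k    ≤⟨ ℚ.+-mono-≤ (expSum≤-initial k (<⇒≤ k<K)) (expTerm≤ (<⇒≤ k<K)) ⟩
      ⟦ k * V ⟧ ℚ.+ ⟦ V ⟧           ≡⟨ ⟦⟧-+ (k * V) V ⟩
      ⟦ k * V + V ⟧                 ≡⟨ cong ⟦_⟧ (+-comm (k * V) V) ⟩
      ⟦ suc k * V ⟧                 ∎

    -- once the terms halve, expSum q j + 2 expTerm q j no longer increases
    potential : ℕ → ℚ
    potential j = expSum q j ℚ.+ expTerm q j ℚ.* ⟦ 2 ⟧

    potential-initial : potential K ℚ.≤ ⟦ (K + 2) * V ⟧
    potential-initial = begin
      expSum q K ℚ.+ expTerm q K ℚ.* ⟦ 2 ⟧
        ≤⟨ ℚ.+-mono-≤ (expSum≤-initial K ≤-refl)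
                      (ℚ.*-monoʳ-≤-nonNeg ⟦ 2 ⟧ {{ℚ.nonNegative (frac-nonNeg 2 0)}} (expTerm≤ ≤-refl)) ⟩
      ⟦ K * V ⟧ ℚ.+ ⟦ V ⟧ ℚ.* ⟦ 2 ⟧   ≡⟨ cong (ℚ._+_ ⟦ K * V ⟧) (⟦⟧-* V 2) ⟩
      ⟦ K * V ⟧ ℚ.+ ⟦ V * 2 ⟧         ≡⟨ ⟦⟧-+ (K * V) (V * 2) ⟩
      ⟦ K * V + V * 2 ⟧               ≡⟨ cong ⟦_⟧ (solve 2 (λ K V → (K :+ con 2) :* V := K :* V :+ V :* con 2) refl K V) ⟨
      ⟦ (K + 2) * V ⟧                 ∎

    potential-step : ∀ j → K ≤ j → potential (suc j) ℚ.≤ potential j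
    potential-step j K≤j = begin
      (expSum q j ℚ.+ expTerm q j) ℚ.+ expTerm q (suc j) ℚ.* ⟦ 2 ⟧
        ≤⟨ ℚ.+-monoʳ-≤ (expSum q j ℚ.+ expTerm q j) (expTerm-halves j K≤j) ⟩
      (expSum q j ℚ.+ expTerm q j) ℚ.+ expTerm q j  ≡⟨ ℚ.+-assoc (expSum q j) (expTerm q j) (expTerm q j) ⟩
      expSum q j ℚ.+ (expTerm q j ℚ.+ expTerm q j)  ≡⟨ cong (ℚ._+_ (expSum q j)) (double (expTerm q j)) ⟨
      potential j                                   ∎
      where
      double : ∀ p → p ℚ.* ⟦ 2 ⟧ ≡ p ℚ.+ p
      double p = trans (cong (λ z → p ℚ.* z) (sym (⟦⟧-+ 1 1)))
                       (trans (ℚ.*-distribˡ-+ p 1ℚ 1ℚ) (cong₂ ℚ._+_ (ℚ.*-identityʳ p) (ℚ.*-identityʳ p)))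

    potential-final : ∀ i → potential (K + i) ℚ.≤ ⟦ (K + 2) * V ⟧
    potential-final zero    = subst (λ j → potential j ℚ.≤ ⟦ (K + 2) * V ⟧) (sym (+-identityʳ K)) potential-initial
    potential-final (suc i) = subst (λ j → potential j ℚ.≤ ⟦ (K + 2) * V ⟧) (sym (+-suc K i))
      (ℚ.≤-trans (potential-step (K + i) (m≤m+n K i)) (potential-final i))

    expSum≤ : ∀ k → expSum q k ℚ.≤ ⟦ (K + 2) * V ⟧
    expSum≤ k with k ≤? K
    ... | yes k≤K = ℚ.≤-trans (expSum≤-initial k k≤K) (⟦⟧-mono (*-monoˡ-≤ V (≤-trans k≤K (m≤m+n K 2))))
    ... | no k≰K  = subst (λ j → expSum q j ℚ.≤ ⟦ (K + 2) * V ⟧) (m+[n∸m]≡n (<⇒≤ (≰⇒> k≰K)))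
        (ℚ.≤-trans (expSum≤potential (K + (k ∸ K))) (potential-final (k ∸ K)))
      where
      expSum≤potential : ∀ j → expSum q j ℚ.≤ potential j
      expSum≤potential j = ℚ.≤-trans (ℚ.≤-reflexive (sym (ℚ.+-identityʳ (expSum q j))))
        (ℚ.+-monoʳ-≤ (expSum q j) (*-nonNeg (expTerm-nonNeg j) (frac-nonNeg 2 0)))

ExpAtMost-nⁿ : ∀ n Q a b → 1 ≤ Q → a ≤ Q * suc b → 2 * Q + 2 ≤ n → ExpAtMost (frac a b) (n ^ n)
ExpAtMost-nⁿ n Q a b 1≤Q a≤Qb 2Q+2≤n k = ℚ.≤-trans (expSum≤ (frac a b) Q (frac-nonNeg a b) q≤Q 1≤Q k) (⟦⟧-mono bound)
  where
  q≤Q : frac a b ℚ.≤ ⟦ Q ⟧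
  q≤Q = frac-mono a b Q 0 (≤-trans (≤-reflexive (*-identityʳ a)) a≤Qb)
  Q≤n : Q ≤ n
  Q≤n = ≤-trans (m≤m+n Q (Q + 0)) (≤-trans (m≤m+n (2 * Q) 2) 2Q+2≤n)
  2Q<n : suc (2 * Q) ≤ n
  2Q<n = ≤-trans (≤-reflexive (+-comm 1 (2 * Q))) (≤-trans (+-monoʳ-≤ (2 * Q) (s≤s z≤n)) 2Q+2≤n)
  bound : (2 * Q + 2) * Q ^ (2 * Q) ≤ n ^ n
  bound = ≤-trans (*-mono-≤ 2Q+2≤n (^-monoˡ-≤ (2 * Q) Q≤n)) (^-monoʳ-≤ n {{>-nonZero (≤-trans (s≤s z≤n) 2Q<n)}} 2Q<n)

WithinBound-mono : ∀ {n m M} → m ≤ M → WithinBound n M → WithinBound n m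
WithinBound-mono {n} m≤M within a b hyp = within a b
  (≤-trans hyp (*-monoˡ-≤ (suc b ^ 2) (^-monoˡ-≤ 3 (∸-monoˡ-≤ n (*-monoʳ-≤ 8 m≤M)))))

^2-cancel-≤ : ∀ {x y} → x ^ 2 ≤ y ^ 2 → x ≤ y
^2-cancel-≤ {x} {y} x²≤y² with x ≤? y
... | yes x≤y = x≤y
... | no x≰y  = contradiction x²≤y² (<⇒≱ (^-monoˡ-< 2 (≰⇒> x≰y)))

-- An admissible s satisfies s² ≤ (8M ∸ n)³ / 2³⁹ ≤ Q², so s ≤ Q and e^s ≤ e^Q ≤ nⁿ.
WithinBound-intro : ∀ n M D Q → (8 * M) ∸ n ≤ D → D ^ 3 ≤ 2 ^ 39 * Q ^ 2 → 1 ≤ Q → 2 * Q + 2 ≤ n → WithinBound n M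
WithinBound-intro n M D Q excess≤D D³≤ 1≤Q 2Q+2≤n a b a²≤ =
  ExpAtMost-nⁿ n Q a b 1≤Q (^2-cancel-≤ (*-cancelʳ-≤ (a ^ 2) ((Q * suc b) ^ 2) (2 ^ 39) {{m^n≢0 2 39}} squares)) 2Q+2≤n
  where
  open ≤-Reasoning
  -- stated for a variable K: checking the solver's proof at K = 2 ^ 39 directly is prohibitively slow
  rearrange : ∀ K q s → K * q ^ 2 * s ^ 2 ≡ (q * s) ^ 2 * K
  rearrange = solve 3 (λ K q s → K :* q :^ 2 :* s :^ 2 := (q :* s) :^ 2 :* K) refl
  squares : a ^ 2 * 2 ^ 39 ≤ (Q * suc b) ^ 2 * 2 ^ 39
  squares = begin
    a ^ 2 * 2 ^ 39                  ≤⟨ a²≤ ⟩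
    ((8 * M) ∸ n) ^ 3 * suc b ^ 2   ≤⟨ *-monoˡ-≤ (suc b ^ 2) (^-monoˡ-≤ 3 excess≤D) ⟩
    D ^ 3 * suc b ^ 2               ≤⟨ *-monoˡ-≤ (suc b ^ 2) D³≤ ⟩
    2 ^ 39 * Q ^ 2 * suc b ^ 2      ≡⟨ rearrange (2 ^ 39) Q (suc b) ⟩
    (Q * suc b) ^ 2 * 2 ^ 39        ∎

does-true⇒ : {A : Set} (a? : Dec A) → does a? ≡ true → A
does-true⇒ (yes a) _ = a

does-false⇒¬ : {A : Set} (a? : Dec A) → does a? ≡ false → ¬ A
does-false⇒¬ (no ¬a) _ = ¬a

module Construction (n w u r : ℕ) .{{_ : NonZero w}} where

  t h a b : ℕ
  t = suc (u + u)
  h = w * t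
  a = 2 * h
  b = n ∸ a

  instance
    h≢0 : NonZero h
    h≢0 = m*n≢0 w t

  -- For p < a, p / h is 0 on the side X = [0, h) and 1 on the side Y = [h, a).
  side<2 : ∀ {p} → p < a → p / h < 2
  side<2 {p} p<a = m<n*o⇒m/o<n {p} {2} {h} p<a

  opposite-sides : ∀ {p q q'} → p < a → q < a → q' < a → p / h ≢ q / h → p / h ≢ q' / h → q / h ≡ q' / h
  opposite-sides p<a q<a q'<a p≁q p≁q' =
    ≢⇒≡-below2 (side<2 q<a) (side<2 q'<a) (side<2 p<a) (≢-sym p≁q) (≢-sym p≁q')

  InnerEdge ABEdge CrossEdge Adjacent : ℕ → ℕ → Set
  InnerEdge p q = p < a × q < a × p / h ≢ q / h × (p + q) % h < r
  ABEdge p q    = p < a × a ≤ q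
  CrossEdge p q = ABEdge p q ⊎ ABEdge q p
  Adjacent p q  = InnerEdge p q ⊎ CrossEdge p q

  adjacent? : ∀ p q → Dec (Adjacent p q)
  adjacent? p q = inner? ⊎-dec cross? p q ⊎-dec cross? q p
    where
    inner? = (p <? a) ×-dec (q <? a) ×-dec ¬? (p / h ≟ q / h) ×-dec ((p + q) % h <? r)
    cross? : ∀ p q → Dec (ABEdge p q)
    cross? p q = (p <? a) ×-dec (a ≤? q)

  Adjacent-sym : ∀ {p q} → Adjacent p q → Adjacent q p
  Adjacent-sym {p} {q} (inj₁ (p<a , q<a , p≁q , s<r)) = inj₁ (q<a , p<a , ≢-sym p≁q , subst (λ s → s % h < r) (+-comm p q) s<r)
  Adjacent-sym (inj₂ (inj₁ e)) = inj₂ (inj₂ e)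
  Adjacent-sym (inj₂ (inj₂ e)) = inj₂ (inj₁ e)

  Adjacent-irrefl : ∀ {p} → ¬ Adjacent p p
  Adjacent-irrefl (inj₁ (_ , _ , p≁p , _))  = p≁p refl
  Adjacent-irrefl (inj₂ (inj₁ (p<a , a≤p))) = <⇒≱ p<a a≤p
  Adjacent-irrefl (inj₂ (inj₂ (p<a , a≤p))) = <⇒≱ p<a a≤p

  inner-sides : ∀ {p q} → InnerEdge p q → (p < h × h ≤ q) ⊎ (q < h × h ≤ p)
  inner-sides {p} {q} (p<a , q<a , p≁q , _) with p / h ≟ 0
  ... | yes p/h≡0 = inj₁ (m/n≡0⇒m<n p/h≡0 , m/n≢0⇒n≤m (λ q/h≡0 → p≁q (trans p/h≡0 (sym q/h≡0))))
  ... | no p/h≢0  = inj₂ (m/n≡0⇒m<n q/h≡0 , m/n≢0⇒n≤m p/h≢0)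
    where
    q/h≡0 : q / h ≡ 0
    q/h≡0 = ≢⇒≡-below2 (side<2 q<a) (s≤s z≤n) (side<2 p<a) (≢-sym p≁q) (≢-sym p/h≢0)

  offset-injective : ∀ {p q q'} → q / h ≡ q' / h → (p + q) % h ≡ (p + q') % h → q ≡ q'
  offset-injective {p} {q} {q'} same-side eq = /-%-injective {h} same-side (%-cancel-+ˡ {h} p {q} {q'} eq)

  -- t divides h, so x mod h and x mod t agree modulo t
  offset-residue : ∀ {x y} → r ≤ t → x % h < r → y % h < r → x % t ≡ y % t → x % h ≡ y % h
  offset-residue {x} {y} r≤t x<r y<r eq = %-injective-< (≤-trans x<r r≤t) (≤-trans y<r r≤t) (begin
    x % h % t  ≡⟨ m∣n⇒o%n%m≡o%m t h x (n∣m*n w) ⟩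
    x % t      ≡⟨ eq ⟩
    y % t      ≡⟨ m∣n⇒o%n%m≡o%m t h y (n∣m*n w) ⟨
    y % h % t  ∎)
    where open ≡-Reasoning

  -- For x ∈ X, y ∈ Y the edge xy gets (x + 2y) mod t, and for p ∈ A, q ∈ B the edge pq gets
  -- t + 4 (p + q) + (q ∸ a) mod 4: in both cases p ⊔ q is the endpoint on the right.
  colourOf : ℕ → ℕ → ℕ
  colourOf s m with m <? a
  ... | yes _ = (s + m) % t
  ... | no _  = t + (s * 4 + (m ∸ a) % 4)

  colour : ℕ → ℕ → ℕ
  colour p q = colourOf (p + q) (p ⊔ q)

  colour-sym : ∀ p q → colour p q ≡ colour q p
  colour-sym p q = cong₂ colourOf (+-comm p q) (⊔-comm p q)

  colour-inner : ∀ {p q} → InnerEdge p q → colour p q ≡ (p + q + (p ⊔ q)) % t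
  colour-inner {p} {q} (p<a , q<a , _) with p ⊔ q <? a
  ... | yes _    = refl
  ... | no ⊔≮a  = contradiction (⊔-pres-<m p<a q<a) ⊔≮a

  colour-cross : ∀ {p q} → CrossEdge p q → colour p q ≡ t + ((p + q) * 4 + (p ⊔ q ∸ a) % 4)
  colour-cross {p} {q} e with p ⊔ q <? a
  ... | no _       = refl
  ... | yes ⊔<a = contradiction ⊔<a (≤⇒≯ (a≤⊔ e))
    where
    a≤⊔ : CrossEdge p q → a ≤ p ⊔ q
    a≤⊔ (inj₁ (_ , a≤q)) = ≤-trans a≤q (m≤n⊔m p q)
    a≤⊔ (inj₂ (_ , a≤p)) = ≤-trans a≤p (m≤m⊔n p q)

  colour-XY : ∀ {p q} → InnerEdge p q → p < h → h ≤ q → colour p q ≡ (p + (q + q)) % t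
  colour-XY {p} {q} e p<h h≤q = trans (colour-inner e)
    (cong (_% t) (trans (cong (λ m → p + q + m) (m≤n⇒m⊔n≡n (<⇒≤ (<-≤-trans p<h h≤q)))) (+-assoc p q q)))

  colour-YX : ∀ {p q} → InnerEdge p q → q < h → h ≤ p → colour p q ≡ ((p + p) + q) % t
  colour-YX {p} {q} e q<h h≤p = trans (colour-inner e)
    (cong (_% t) (trans (cong (λ m → p + q + m) (m≥n⇒m⊔n≡m (<⇒≤ (<-≤-trans q<h h≤p))))
                        (solve 2 (λ p q → p :+ q :+ p := p :+ p :+ q) refl p q)))

  inner-colour<t : ∀ {p q} → InnerEdge p q → colour p q < t
  inner-colour<t {p} {q} e = subst (_< t) (sym (colour-inner e)) (m%n<n (p + q + (p ⊔ q)) t)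

  t≤cross-colour : ∀ {p q} → CrossEdge p q → t ≤ colour p q
  t≤cross-colour e = subst (t ≤_) (sym (colour-cross e)) (m≤m+n t _)

  inner-colour-injective : ∀ {p q q'} → r ≤ t → InnerEdge p q → InnerEdge p q' → colour p q ≡ colour p q' → q ≡ q'
  inner-colour-injective {p} {q} {q'} r≤t e@(p<a , q<a , p≁q , s<r) e'@(_ , q'<a , p≁q' , s'<r) eq =
    offset-injective (opposite-sides p<a q<a q'<a p≁q p≁q') (offset-residue r≤t s<r s'<r (%-cong-+ˡ p {q} {q'} residue))
    where
    residue : q % t ≡ q' % t
    residue with inner-sides e | inner-sides e'
    ... | inj₁ (p<h , h≤q) | inj₁ (_ , h≤q')  = %-cancel-double u {q} {q'} (%-cancel-+ˡ p {q + q} {q' + q'}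
      (trans (sym (colour-XY e p<h h≤q)) (trans eq (colour-XY e' p<h h≤q'))))
    ... | inj₂ (q<h , h≤p) | inj₂ (q'<h , _)  = %-cancel-+ˡ (p + p) {q} {q'}
      (trans (sym (colour-YX e q<h h≤p)) (trans eq (colour-YX e' q'<h h≤p)))
    ... | inj₁ (p<h , _)   | inj₂ (_ , h≤p)   = contradiction h≤p (<⇒≱ p<h)
    ... | inj₂ (_ , h≤p)   | inj₁ (p<h , _)   = contradiction h≤p (<⇒≱ p<h)

  cross-colour-injective : ∀ {p q q'} → CrossEdge p q → CrossEdge p q' → colour p q ≡ colour p q' → q ≡ q'
  cross-colour-injective {p} {q} {q'} e e' eq = +-cancelˡ-≡ p q q'
    (proj₁ (*-+-injective 4 (m%n<n ((p ⊔ q) ∸ a) 4) (m%n<n ((p ⊔ q') ∸ a) 4)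
      (+-cancelˡ-≡ t _ _ (trans (sym (colour-cross e)) (trans eq (colour-cross e'))))))

  colour-injective : ∀ {p q q'} → r ≤ t → Adjacent p q → Adjacent p q' → colour p q ≡ colour p q' → q ≡ q'
  colour-injective r≤t (inj₁ e) (inj₁ e') eq = inner-colour-injective r≤t e e' eq
  colour-injective r≤t (inj₂ e) (inj₂ e') eq = cross-colour-injective e e' eq
  colour-injective r≤t (inj₁ e) (inj₂ e') eq = contradiction (subst (t ≤_) (sym eq) (t≤cross-colour e')) (<⇒≱ (inner-colour<t e))
  colour-injective r≤t (inj₂ e) (inj₁ e') eq = contradiction (subst (t ≤_) eq (t≤cross-colour e)) (<⇒≱ (inner-colour<t e'))

  non-adjacent-from-A : ∀ {p q} → p < a → ¬ Adjacent p q → q < a × (p / h ≢ q / h → r ≤ (p + q) % h)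
  non-adjacent-from-A {p} {q} p<a p≁q = q<a , λ sides≢ → ≮⇒≥ (λ s<r → p≁q (inj₁ (p<a , q<a , sides≢ , s<r)))
    where
    q<a : q < a
    q<a = ≰⇒> (λ a≤q → p≁q (inj₂ (inj₁ (p<a , a≤q))))

  non-adjacent-from-B : ∀ {p q} → a ≤ p → ¬ Adjacent p q → a ≤ q
  non-adjacent-from-B a≤p p≁q = ≮⇒≥ (λ q<a → p≁q (inj₂ (inj₂ (q<a , a≤p))))

  -- For p ∈ A, q ↦ (p + q) mod h is injective on each side, and at least r on the non-neighbours
  -- of p on the other side.
  sideCode : ∀ {p q} → Dec (q / h ≡ p / h) → ℕ
  sideCode {p} {q} (yes _) = (p + q) % h
  sideCode {p} {q} (no _)  = h + ((p + q) % h ∸ r)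

  sideCode< : ∀ {p q} → p < a → ¬ Adjacent p q → (same? : Dec (q / h ≡ p / h)) → sideCode same? < h + (h ∸ r)
  sideCode< {p} {q} p<a p≁q (yes _)     = <-≤-trans (m%n<n (p + q) h) (m≤m+n h (h ∸ r))
  sideCode< {p} {q} p<a p≁q (no sides≢) =
    +-monoʳ-< h (∸-monoˡ-< (m%n<n (p + q) h) (proj₂ (non-adjacent-from-A p<a p≁q) (≢-sym sides≢)))

  sideCode-injective : ∀ {p q q'} → p < a → ¬ Adjacent p q → ¬ Adjacent p q' →
                       (same? : Dec (q / h ≡ p / h)) (same?' : Dec (q' / h ≡ p / h)) →
                       sideCode same? ≡ sideCode same?' → q ≡ q'
  sideCode-injective p<a _ _ (yes q~p) (yes q'~p) eq = offset-injective (trans q~p (sym q'~p)) eq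
  sideCode-injective {p} {q} {q'} p<a p≁q p≁q' (no q≁p) (no q'≁p) eq =
    offset-injective (opposite-sides p<a q<a q'<a (≢-sym q≁p) (≢-sym q'≁p))
      (∸-cancelʳ-≡ (far p≁q (≢-sym q≁p)) (far p≁q' (≢-sym q'≁p)) (+-cancelˡ-≡ h _ _ eq))
    where
    q<a = proj₁ (non-adjacent-from-A p<a p≁q)
    q'<a = proj₁ (non-adjacent-from-A p<a p≁q')
    far : ∀ {q} → ¬ Adjacent p q → p / h ≢ q / h → r ≤ (p + q) % h
    far p≁q = proj₂ (non-adjacent-from-A p<a p≁q)
  sideCode-injective {p} {q} {q'} _ _ _ (yes _) (no _) eq =
    contradiction (subst (_< h) eq (m%n<n (p + q) h)) (≤⇒≯ (m≤m+n h _))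
  sideCode-injective {p} {q} {q'} _ _ _ (no _) (yes _) eq =
    contradiction (subst (_< h) (sym eq) (m%n<n (p + q') h)) (≤⇒≯ (m≤m+n h _))

  ordered-edge : ∀ {x y} → x < y → Adjacent x y → (InnerEdge x y × x < h × h ≤ y) ⊎ ABEdge x y
  ordered-edge x<y (inj₁ e) with inner-sides e
  ... | inj₁ (x<h , h≤y) = inj₁ (e , x<h , h≤y)
  ... | inj₂ (y<h , h≤x) = contradiction (<-≤-trans y<h h≤x) (<⇒≯ x<y)
  ordered-edge x<y (inj₂ (inj₁ e))          = inj₂ e
  ordered-edge x<y (inj₂ (inj₂ (y<a , a≤x))) = contradiction (<-≤-trans y<a a≤x) (<⇒≯ x<y)

  -- Within one colour class, an inner edge xy (x < y) is determined by the block x / t and the offset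
  -- (x + y) mod h, and an edge between A and B by (y ∸ a) / 4.
  classCode : ℕ → ℕ → ℕ
  classCode x y with y <? a
  ... | yes _ = (x / t) * r + (x + y) % h
  ... | no _  = (y ∸ a) / 4

  classCode-inner : ∀ {x y} → InnerEdge x y → classCode x y ≡ (x / t) * r + (x + y) % h
  classCode-inner {x} {y} (_ , y<a , _) with y <? a
  ... | yes _   = refl
  ... | no y≮a = contradiction y<a y≮a

  classCode-AB : ∀ {x y} → ABEdge x y → classCode x y ≡ (y ∸ a) / 4
  classCode-AB {x} {y} (_ , a≤y) with y <? a
  ... | yes y<a = contradiction a≤y (<⇒≱ y<a)
  ... | no _    = refl

  classCode< : ∀ {x y} → b ≤ w * r * 4 → y < n → x < y → Adjacent x y → classCode x y < w * r
  classCode< {x} {y} b≤4wr y<n x<y e with ordered-edge x<y e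
  ... | inj₁ (e@(_ , _ , _ , s<r) , x<h , _) = begin-strict
    classCode x y                  ≡⟨ classCode-inner e ⟩
    (x / t) * r + (x + y) % h      <⟨ +-monoʳ-< ((x / t) * r) s<r ⟩
    (x / t) * r + r                ≡⟨ +-comm ((x / t) * r) r ⟩
    suc (x / t) * r                ≤⟨ *-monoˡ-≤ r (m<n*o⇒m/o<n {x} {w} {t} x<h) ⟩
    w * r                          ∎
    where open ≤-Reasoning
  ... | inj₂ e@(_ , a≤y) = subst (_< w * r) (sym (classCode-AB e))
    (m<n*o⇒m/o<n (<-≤-trans (∸-monoˡ-< y<n a≤y) b≤4wr))

  inner-classCode-injective : ∀ {x y x' y'} → InnerEdge x y → x < h → h ≤ y → InnerEdge x' y' → x' < h → h ≤ y' →
    colour x y ≡ colour x' y' → classCode x y ≡ classCode x' y' → x ≡ x' × y ≡ y'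
  inner-classCode-injective {x} {y} {x'} {y'} e@(_ , y<a , _ , s<r) x<h h≤y e'@(_ , y'<a , _ , s'<r) x'<h h≤y' colour≡ code≡ =
    x≡x' , offset-injective y-side≡ (trans s≡s' (cong (λ z → (z + y') % h) (sym x≡x')))
    where
    block&offset = *-+-injective r s<r s'<r (trans (sym (classCode-inner e)) (trans code≡ (classCode-inner e')))
    s≡s' : (x + y) % h ≡ (x' + y') % h
    s≡s' = proj₂ block&offset
    sum-residue : (x + y) % t ≡ (x' + y') % t
    sum-residue = trans (sym (m∣n⇒o%n%m≡o%m t h (x + y) (n∣m*n w)))
                 (trans (cong (_% t) s≡s') (m∣n⇒o%n%m≡o%m t h (x' + y') (n∣m*n w)))
    y-residue : y % t ≡ y' % t
    y-residue = %-cancel-+ˡ (x' + y') (begin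
      (x' + y' + y) % t   ≡⟨ %-cong-+ʳ y {x' + y'} {x + y} (sym sum-residue) ⟩
      (x + y + y) % t     ≡⟨ cong (_% t) (+-assoc x y y) ⟩
      (x + (y + y)) % t   ≡⟨ trans (sym (colour-XY e x<h h≤y)) (trans colour≡ (colour-XY e' x'<h h≤y')) ⟩
      (x' + (y' + y')) % t ≡⟨ cong (_% t) (+-assoc x' y' y') ⟨
      (x' + y' + y') % t  ∎)
      where open ≡-Reasoning
    x-residue : x % t ≡ x' % t
    x-residue = %-cancel-+ˡ y' (begin
      (y' + x) % t  ≡⟨ %-cong-+ʳ x {y'} {y} (sym y-residue) ⟩
      (y + x) % t   ≡⟨ cong (_% t) (+-comm y x) ⟩
      (x + y) % t   ≡⟨ sum-residue ⟩
      (x' + y') % t ≡⟨ cong (_% t) (+-comm x' y') ⟩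
      (y' + x') % t ∎)
      where open ≡-Reasoning
    x≡x' : x ≡ x'
    x≡x' = /-%-injective (proj₁ block&offset) x-residue
    y-side≡ : y / h ≡ y' / h
    y-side≡ = ≢⇒≡-below2 (side<2 y<a) (side<2 y'<a) (s≤s z≤n) (>⇒≢ (m≥n⇒m/n>0 h≤y)) (>⇒≢ (m≥n⇒m/n>0 h≤y'))

  colour-AB : ∀ {x y} → ABEdge x y → colour x y ≡ t + ((x + y) * 4 + (y ∸ a) % 4)
  colour-AB {x} {y} e@(x<a , a≤y) = trans (colour-cross (inj₁ e))
    (cong (λ m → t + ((x + y) * 4 + (m ∸ a) % 4)) (m≤n⇒m⊔n≡n (<⇒≤ (<-≤-trans x<a a≤y))))

  AB-classCode-injective : ∀ {x y x' y'} → ABEdge x y → ABEdge x' y' →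
    colour x y ≡ colour x' y' → classCode x y ≡ classCode x' y' → x ≡ x' × y ≡ y'
  AB-classCode-injective {x} {y} {x'} {y'} e@(_ , a≤y) e'@(_ , a≤y') colour≡ code≡ =
    +-cancelʳ-≡ y x x' (trans (proj₁ sum&residue) (cong (λ z → x' + z) (sym y≡y'))) , y≡y'
    where
    sum&residue = *-+-injective 4 (m%n<n (y ∸ a) 4) (m%n<n (y' ∸ a) 4)
      (+-cancelˡ-≡ t _ _ (trans (sym (colour-AB e)) (trans colour≡ (colour-AB e'))))
    y≡y' : y ≡ y'
    y≡y' = ∸-cancelʳ-≡ a≤y a≤y'
      (/-%-injective (trans (sym (classCode-AB e)) (trans code≡ (classCode-AB e'))) (proj₂ sum&residue))

  classCode-injective : ∀ {x y x' y'} → x < y → x' < y' → Adjacent x y → Adjacent x' y' →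
    colour x y ≡ colour x' y' → classCode x y ≡ classCode x' y' → x ≡ x' × y ≡ y'
  classCode-injective x<y x'<y' e e' colour≡ code≡ with ordered-edge x<y e | ordered-edge x'<y' e'
  ... | inj₁ (e , x<h , h≤y) | inj₁ (e' , x'<h , h≤y') =
    inner-classCode-injective e x<h h≤y e' x'<h h≤y' colour≡ code≡
  ... | inj₂ e | inj₂ e' = AB-classCode-injective e e' colour≡ code≡
  ... | inj₁ (e , _) | inj₂ e' =
    contradiction (subst (t ≤_) (sym colour≡) (t≤cross-colour (inj₁ e'))) (<⇒≱ (inner-colour<t e))
  ... | inj₂ e | inj₁ (e' , _) =
    contradiction (subst (t ≤_) colour≡ (t≤cross-colour (inj₁ e))) (<⇒≱ (inner-colour<t e'))

  adjacent-true : ∀ {p q} → does (adjacent? p q) ≡ true → Adjacent p q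
  adjacent-true {p} {q} = does-true⇒ (adjacent? p q)

  adjacent-false : ∀ {p q} → does (adjacent? p q) ≡ false → ¬ Adjacent p q
  adjacent-false {p} {q} = does-false⇒¬ (adjacent? p q)

  graph : Graph n
  graph = record
    { adj    = λ v w → does (adjacent? (toℕ v) (toℕ w))
    ; sym    = λ v w → does-⇔ (mk⇔ Adjacent-sym Adjacent-sym) (adjacent? (toℕ v) (toℕ w)) (adjacent? (toℕ w) (toℕ v))
    ; irrefl = λ v → dec-false (adjacent? (toℕ v) (toℕ v)) Adjacent-irrefl
    }

  colouring : Colouring n
  colouring v w = colour (toℕ v) (toℕ w)

  isEdgeColouring : IsEdgeColouring graph colouring
  isEdgeColouring v w _ = colour-sym (toℕ v) (toℕ w)

  isProper : r ≤ t → Proper graph colouring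
  isProper r≤t v w w' vw vw' w≢w' eq = w≢w' (toℕ-injective (colour-injective r≤t (adjacent-true vw) (adjacent-true vw') eq))

  degree-B : ∀ {v} → a ≤ n → a ≤ toℕ v → a ≤ degree graph v
  degree-B {v} a≤n a≤v = subst (_≤ degree graph v) (m∸[m∸n]≡n a≤n)
    (nonNeighbourCode⇒degree≥ graph v b (λ w → toℕ w ∸ a)
      (λ {w} v≁w → ∸-monoˡ-< (toℕ<n w) (non-adjacent-from-B a≤v (adjacent-false v≁w)))
      (λ v≁w v≁w' eq → toℕ-injective (∸-cancelʳ-≡ (non-adjacent-from-B a≤v (adjacent-false v≁w))
                                                   (non-adjacent-from-B a≤v (adjacent-false v≁w')) eq)))

  degree-A : ∀ {v} → r ≤ h → a ≤ n → toℕ v < a → b + r ≤ degree graph v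
  degree-A {v} r≤h a≤n v<a = subst (_≤ degree graph v) n∸non-neighbours
    (nonNeighbourCode⇒degree≥ graph v (h + (h ∸ r)) (λ w → sideCode (toℕ w / h ≟ toℕ v / h))
      (λ {w} v≁w → sideCode< v<a (adjacent-false v≁w) (toℕ w / h ≟ toℕ v / h))
      (λ {w} {w'} v≁w v≁w' eq → toℕ-injective
        (sideCode-injective v<a (adjacent-false v≁w) (adjacent-false v≁w') (toℕ w / h ≟ toℕ v / h) (toℕ w' / h ≟ toℕ v / h) eq)))
    where
    n∸non-neighbours : n ∸ (h + (h ∸ r)) ≡ b + r
    n∸non-neighbours = begin
      n ∸ (h + (h ∸ r))                       ≡⟨ cong (_∸ (h + (h ∸ r))) n≡ ⟨
      (h + (h ∸ r)) + (b + r) ∸ (h + (h ∸ r)) ≡⟨ m+n∸m≡n (h + (h ∸ r)) (b + r) ⟩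
      b + r                                   ∎
      where
      open ≡-Reasoning
      n≡ : (h + (h ∸ r)) + (b + r) ≡ n
      n≡ = begin
        (h + (h ∸ r)) + (b + r)   ≡⟨ solve 4 (λ h d b r → (h :+ d) :+ (b :+ r) := (h :+ (d :+ r)) :+ b) refl h (h ∸ r) b r ⟩
        (h + ((h ∸ r) + r)) + b   ≡⟨ cong (λ z → (h + z) + b) (m∸n+n≡m r≤h) ⟩
        (h + h) + b               ≡⟨ cong (_+ b) (cong (λ z → h + z) (+-identityʳ h)) ⟨
        a + b                     ≡⟨ m+[n∸m]≡n a≤n ⟩
        n                         ∎

  minDegree : r ≤ t → a ≤ n → n + 2 ≤ 2 * a → n + 2 ≤ 2 * (b + r) → MinDegreeAtLeastHalfPlusOne graph
  minDegree r≤t a≤n n+2≤2a n+2≤2[b+r] v with a ≤? toℕ v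
  ... | yes a≤v = ≤-trans n+2≤2a (*-monoʳ-≤ 2 (degree-B a≤n a≤v))
  ... | no a≰v  = ≤-trans n+2≤2[b+r] (*-monoʳ-≤ 2 (degree-A (≤-trans r≤t (m≤n*m t w)) a≤n (≰⇒> a≰v)))

  bounded : b ≤ w * r * 4 → WithinBound n (w * r) → BoundedColouring graph colouring
  bounded b≤4wr within k = WithinBound-mono {n} (classCode⇒colourClassSize≤ graph colouring k (w * r)
      (λ v w → classCode (toℕ v) (toℕ w))
      (λ {v} {w} (v<w , vw , _) → classCode< b≤4wr (toℕ<n w) v<w (adjacent-true vw))
      (λ (v<w , vw , vw≡k) (v'<w' , v'w' , v'w'≡k) eq →
        let (v≡ , w≡) = classCode-injective v<w v'<w' (adjacent-true vw) (adjacent-true v'w') (trans vw≡k (sym v'w'≡k)) eq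
        in toℕ-injective v≡ , toℕ-injective w≡))
    within

  noRainbow : b + b + t < n → (H : HamiltonCycle graph) → ¬ Rainbow colouring H
  noRainbow = noRainbowHamiltonCycle graph colouring a t
    (λ a≤v a≤w → dec-false (adjacent? _ _) (B-independent a≤v a≤w))
    (λ v<a w<a vw → A-colour<t v<a w<a (adjacent-true vw))
    where
    B-independent : ∀ {p q} → a ≤ p → a ≤ q → ¬ Adjacent p q
    B-independent a≤p a≤q (inj₁ (p<a , _)) = <⇒≱ p<a a≤p
    B-independent a≤p a≤q (inj₂ (inj₁ (p<a , _))) = <⇒≱ p<a a≤p
    B-independent a≤p a≤q (inj₂ (inj₂ (q<a , _))) = <⇒≱ q<a a≤q
    A-colour<t : ∀ {p q} → p < a → q < a → Adjacent p q → colour p q < t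
    A-colour<t _ _ (inj₁ e) = inner-colour<t e
    A-colour<t _ q<a (inj₂ (inj₁ (_ , a≤q))) = contradiction a≤q (<⇒≱ q<a)
    A-colour<t p<a _ (inj₂ (inj₂ (_ , a≤p))) = contradiction a≤p (<⇒≱ p<a)

record Admissible (n : ℕ) : Set where
  field
    w u r : ℕ
    {{w≢0}} : NonZero w
  open Construction n w u r using (t; a; b)
  field
    r≤t : r ≤ t
    a≤n : a ≤ n
    n+2≤2a : n + 2 ≤ 2 * a
    n+2≤2[b+r] : n + 2 ≤ 2 * (b + r)
    b+b+t<n : b + b + t < n
    b≤4wr : b ≤ w * r * 4
    within : WithinBound n (w * r)

cube-root : ∀ n → ∃ λ k → 8 * k ^ 3 ≤ n × n < 8 * suc k ^ 3
cube-root zero = 0 , z≤n , s≤s z≤n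
cube-root (suc n) with cube-root n
... | k , lo , hi with suc n <? 8 * suc k ^ 3
...   | yes n+1<  = k , m≤n⇒m≤1+n lo , n+1<
...   | no n+1≮   = suc k , ≮⇒≥ n+1≮ , ≤-<-trans hi (*-monoʳ-< 8 (^-monoˡ-< 3 (n<1+n (suc k))))

odd-multiple-above : ∀ M → 1 ≤ M → ∀ n → ∃ λ u → n + 1 ≤ suc (u + u) * M × suc (u + u) * M ≤ n + 2 * M
odd-multiple-above M 1≤M zero =
  0 , ≤-trans 1≤M (≤-reflexive (sym (+-identityʳ M))) , ≤-trans (≤-reflexive (+-identityʳ M)) (m≤m+n M (M + 0))
odd-multiple-above M 1≤M (suc n) with odd-multiple-above M 1≤M n
... | u , lo , hi with suc n + 1 ≤? suc (u + u) * M
...   | yes lo' = u , lo' , ≤-trans hi (+-monoˡ-≤ (2 * M) (n≤1+n n))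
...   | no lo≰  = suc u , subst (suc n + 1 ≤_) (sym t'M≡)
                          (≤-trans (≤-reflexive (+-comm 1 (n + 1))) (+-monoʳ-≤ (n + 1) (≤-trans 1≤M (m≤m+n M (M + 0)))))
                        , ≤-reflexive (trans t'M≡ (cong (_+ 2 * M) (+-comm n 1)))
  where
  tM≡ : suc (u + u) * M ≡ n + 1
  tM≡ = ≤-antisym (≤-pred (≰⇒> lo≰)) lo
  t'M≡ : suc (suc u + suc u) * M ≡ n + 1 + 2 * M
  t'M≡ = begin
    suc (suc u + suc u) * M    ≡⟨ solve 2 (λ u M → (con 1 :+ ((con 1 :+ u) :+ (con 1 :+ u))) :* M := (con 1 :+ (u :+ u)) :* M :+ con 2 :* M) refl u M ⟩
    suc (u + u) * M + 2 * M    ≡⟨ cong (_+ 2 * M) tM≡ ⟩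
    n + 1 + 2 * M              ∎
    where open ≡-Reasoning

⌈n/2⌉-double : ∀ x → x ≤ ⌈ x /2⌉ + ⌈ x /2⌉ × ⌈ x /2⌉ + ⌈ x /2⌉ ≤ suc x
⌈n/2⌉-double zero          = z≤n , z≤n
⌈n/2⌉-double (suc zero)    = s≤s z≤n , ≤-refl
⌈n/2⌉-double (suc (suc x)) with ⌈n/2⌉-double x
... | lo , hi = ≤-trans (s≤s (s≤s lo)) (≤-reflexive (cong suc (sym (+-suc c c))))
              , ≤-trans (≤-reflexive (cong suc (+-suc c c))) (s≤s (s≤s hi))
  where c = ⌈ x /2⌉

-- w = 4 + v and m = 4w - 1 = 15 + 4v are written in terms of v, so that the polynomial inequalities
-- below have nonnegative coefficients.
module Choice (n v u : ℕ) (n≥ : 8 * (4 + v) ^ 3 ≤ n) (n< : n < 8 * (5 + v) ^ 3)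
              (tm≥ : n + 1 ≤ suc (u + u) * (15 + 4 * v)) (tm≤ : suc (u + u) * (15 + 4 * v) ≤ n + 2 * (15 + 4 * v)) where

  w m t h a b e r : ℕ
  w = 4 + v
  m = 15 + 4 * v
  t = suc (u + u)
  h = w * t
  a = 2 * h
  b = n ∸ a
  e = 2 * a ∸ n
  r = ⌈ (e + 2) /2⌉

  2a≡ : 2 * a ≡ t * m + t
  2a≡ = solve 2 (λ v t → con 2 :* (con 2 :* ((con 4 :+ v) :* t)) := t :* (con 15 :+ con 4 :* v) :+ t) refl v t

  n<tm : n < t * m
  n<tm = ≤-trans (≤-reflexive (+-comm 1 n)) tm≥

  ≤-witness : ∀ {x y} d → x + d ≡ y → x ≤ y
  ≤-witness {x} d eq = ≤-trans (m≤m+n x d) (≤-reflexive eq)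

  t≥33+8v : 33 + 8 * v ≤ t
  t≥33+8v with 33 + 8 * v ≤? t
  ... | yes le  = le
  ... | no t≤   = contradiction (≤-trans n<tm (≤-trans (*-monoˡ-≤ m (≤-pred (≰⇒> t≤))) (≤-witness _ poly))) (≤⇒≯ n≥)
    where
    poly : (32 + 8 * v) * m + (32 + 136 * v + 64 * v ^ 2 + 8 * v ^ 3) ≡ 8 * w ^ 3
    poly = solve 1 (λ v → (con 32 :+ con 8 :* v) :* (con 15 :+ con 4 :* v) :+ (con 32 :+ con 136 :* v :+ con 64 :* v :^ 2 :+ con 8 :* v :^ 3)
                         := con 8 :* (con 4 :+ v) :^ 3) refl v

  t≤6w² : t ≤ 6 * w ^ 2
  t≤6w² with t ≤? 6 * w ^ 2
  ... | yes le = le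
  ... | no t≰  = contradiction tm≤
    (<⇒≱ (<-≤-trans (+-monoˡ-< (2 * m) n<) (≤-trans (≤-witness _ poly) (*-monoˡ-≤ m (≰⇒> t≰)))))
    where
    poly : 8 * (5 + v) ^ 3 + 2 * m + (425 + 500 * v + 162 * v ^ 2 + 16 * v ^ 3) ≡ (1 + 6 * w ^ 2) * m
    poly = solve 1 (λ v → con 8 :* (con 5 :+ v) :^ 3 :+ con 2 :* (con 15 :+ con 4 :* v) :+ (con 425 :+ con 500 :* v :+ con 162 :* v :^ 2 :+ con 16 :* v :^ 3)
                         := (con 1 :+ con 6 :* (con 4 :+ v) :^ 2) :* (con 15 :+ con 4 :* v)) refl v

  t+2m≤n : t + 2 * m ≤ n
  t+2m≤n = ≤-trans (+-monoˡ-≤ (2 * m) t≤6w²) (≤-trans (≤-witness _ poly) n≥)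
    where
    poly : 6 * w ^ 2 + 2 * m + (386 + 328 * v + 90 * v ^ 2 + 8 * v ^ 3) ≡ 8 * w ^ 3
    poly = solve 1 (λ v → con 6 :* (con 4 :+ v) :^ 2 :+ con 2 :* (con 15 :+ con 4 :* v) :+ (con 386 :+ con 328 :* v :+ con 90 :* v :^ 2 :+ con 8 :* v :^ 3)
                         := con 8 :* (con 4 :+ v) :^ 3) refl v

  2a≤n+2m+t : 2 * a ≤ n + 2 * m + t
  2a≤n+2m+t = ≤-trans (≤-reflexive 2a≡) (+-monoˡ-≤ t tm≤)

  a≤n : a ≤ n
  a≤n = *-cancelˡ-≤ 2 (begin
    2 * a              ≤⟨ 2a≤n+2m+t ⟩
    n + 2 * m + t      ≡⟨ solve 3 (λ n m t → n :+ con 2 :* m :+ t := n :+ (t :+ con 2 :* m)) refl n m t ⟩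
    n + (t + 2 * m)    ≤⟨ +-monoʳ-≤ n t+2m≤n ⟩
    n + n              ≡⟨ solve 1 (λ n → n :+ n := con 2 :* n) refl n ⟩
    2 * n              ∎)
    where open ≤-Reasoning

  n+e≡2a : n + e ≡ 2 * a
  n+e≡2a = m+[n∸m]≡n (≤-trans (≤-trans (m≤m+n n 1) tm≥) (≤-trans (m≤m+n (t * m) t) (≤-reflexive (sym 2a≡))))

  a+b≡n : a + b ≡ n
  a+b≡n = m+[n∸m]≡n a≤n

  b+e≡a : b + e ≡ a
  b+e≡a = +-cancelˡ-≡ a _ _ (begin
    a + (b + e)   ≡⟨ +-assoc a b e ⟨
    a + b + e     ≡⟨ cong (_+ e) a+b≡n ⟩
    n + e         ≡⟨ n+e≡2a ⟩
    2 * a         ≡⟨ solve 1 (λ a → con 2 :* a := a :+ a) refl a ⟩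
    a + a         ∎)
    where open ≡-Reasoning

  t<e : t < e
  t<e = +-cancelˡ-≤ n _ _ (begin
    n + suc t     ≡⟨ +-suc n t ⟩
    suc n + t     ≡⟨ cong (_+ t) (+-comm 1 n) ⟩
    n + 1 + t     ≤⟨ +-monoˡ-≤ t tm≥ ⟩
    t * m + t     ≡⟨ 2a≡ ⟨
    2 * a         ≡⟨ n+e≡2a ⟨
    n + e         ∎)
    where open ≤-Reasoning

  e≤t+2m : e ≤ t + 2 * m
  e≤t+2m = +-cancelˡ-≤ n _ _ (begin
    n + e             ≡⟨ n+e≡2a ⟩
    2 * a             ≤⟨ 2a≤n+2m+t ⟩
    n + 2 * m + t     ≡⟨ solve 3 (λ n m t → n :+ con 2 :* m :+ t := n :+ (t :+ con 2 :* m)) refl n m t ⟩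
    n + (t + 2 * m)   ∎)
    where open ≤-Reasoning

  e+2≤2r : e + 2 ≤ r + r
  e+2≤2r = proj₁ (⌈n/2⌉-double (e + 2))

  2r≤e+3 : r + r ≤ e + 3
  2r≤e+3 = ≤-trans (proj₂ (⌈n/2⌉-double (e + 2))) (≤-reflexive (sym (+-suc e 2)))

  r≤t : r ≤ t
  r≤t = *-cancelˡ-≤ 2 (begin
    2 * r              ≡⟨ solve 1 (λ r → con 2 :* r := r :+ r) refl r ⟩
    r + r              ≤⟨ 2r≤e+3 ⟩
    e + 3              ≤⟨ +-monoˡ-≤ 3 e≤t+2m ⟩
    t + 2 * m + 3      ≡⟨ solve 2 (λ t v → t :+ con 2 :* (con 15 :+ con 4 :* v) :+ con 3 := t :+ (con 33 :+ con 8 :* v)) refl t v ⟩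
    t + (33 + 8 * v)   ≤⟨ +-monoʳ-≤ t t≥33+8v ⟩
    t + t              ≡⟨ solve 1 (λ t → t :+ t := con 2 :* t) refl t ⟩
    2 * t              ∎)
    where open ≤-Reasoning

  n+2≤2a : n + 2 ≤ 2 * a
  n+2≤2a = ≤-trans (+-monoʳ-≤ n (≤-trans (s≤s (s≤s z≤n)) t<e)) (≤-reflexive n+e≡2a)

  n+2≤2[b+r] : n + 2 ≤ 2 * (b + r)
  n+2≤2[b+r] = begin
    n + 2                ≡⟨ cong (_+ 2) a+b≡n ⟨
    a + b + 2            ≡⟨ cong (λ z → z + b + 2) b+e≡a ⟨
    b + e + b + 2        ≡⟨ solve 3 (λ b e x → b :+ e :+ b :+ x := b :+ b :+ (e :+ x)) refl b e 2 ⟩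
    b + b + (e + 2)      ≤⟨ +-monoʳ-≤ (b + b) e+2≤2r ⟩
    b + b + (r + r)      ≡⟨ solve 2 (λ b r → b :+ b :+ (r :+ r) := con 2 :* (b :+ r)) refl b r ⟩
    2 * (b + r)          ∎
    where open ≤-Reasoning

  b+b+t<n : b + b + t < n
  b+b+t<n = begin-strict
    b + b + t   <⟨ +-monoʳ-< (b + b) t<e ⟩
    b + b + e   ≡⟨ +-assoc b b e ⟩
    b + (b + e) ≡⟨ cong (λ z → b + z) b+e≡a ⟩
    b + a       ≡⟨ +-comm b a ⟩
    a + b       ≡⟨ a+b≡n ⟩
    n           ∎
    where open ≤-Reasoning

  b≤4wr : b ≤ w * r * 4
  b≤4wr = begin
    b                    ≤⟨ m≤m+n b e ⟩
    b + e                ≡⟨ b+e≡a ⟩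
    2 * (w * t)          ≤⟨ *-monoʳ-≤ 2 (*-monoʳ-≤ w t≤2r) ⟩
    2 * (w * (r + r))    ≡⟨ solve 2 (λ w r → con 2 :* (w :* (r :+ r)) := w :* r :* con 4) refl w r ⟩
    w * r * 4            ∎
    where
    open ≤-Reasoning
    t≤2r : t ≤ r + r
    t≤2r = ≤-trans (<⇒≤ t<e) (≤-trans (m≤m+n e 2) e+2≤2r)

  -- the error term: 8wr exceeds n by at most D = 64w², and D³ ≤ 2³⁹ Q² for Q = 2w³
  D Q : ℕ
  D = 64 * w ^ 2
  Q = 2 * w ^ 3

  8wr≤n+D : 8 * (w * r) ≤ n + D
  8wr≤n+D = begin
    8 * (w * r)                          ≡⟨ solve 2 (λ w r → con 8 :* (w :* r) := con 4 :* w :* (r :+ r)) refl w r ⟩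
    4 * w * (r + r)                      ≤⟨ *-monoʳ-≤ (4 * w) (≤-trans 2r≤e+3 (+-monoˡ-≤ 3 e≤t+2m)) ⟩
    4 * w * (t + 2 * m + 3)              ≡⟨ solve 2 (λ v t → con 4 :* (con 4 :+ v) :* (t :+ con 2 :* (con 15 :+ con 4 :* v) :+ con 3)
                                             := con 2 :* (con 2 :* ((con 4 :+ v) :* t)) :+ con 4 :* (con 4 :+ v) :* (con 2 :* (con 15 :+ con 4 :* v) :+ con 3)) refl v t ⟩
    2 * a + 4 * w * (2 * m + 3)          ≤⟨ +-monoˡ-≤ (4 * w * (2 * m + 3)) 2a≤n+2m+t ⟩
    n + 2 * m + t + 4 * w * (2 * m + 3)  ≤⟨ +-monoˡ-≤ (4 * w * (2 * m + 3)) (+-monoʳ-≤ (n + 2 * m) t≤6w²) ⟩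
    n + 2 * m + 6 * w ^ 2 + 4 * w * (2 * m + 3)
                                         ≤⟨ ≤-witness (370 + 196 * v + 26 * v ^ 2) poly ⟩
    n + D                                ∎
    where
    open ≤-Reasoning
    poly : n + 2 * m + 6 * w ^ 2 + 4 * w * (2 * m + 3) + (370 + 196 * v + 26 * v ^ 2) ≡ n + D
    poly = solve 2 (λ n v → n :+ con 2 :* (con 15 :+ con 4 :* v) :+ con 6 :* (con 4 :+ v) :^ 2 :+ con 4 :* (con 4 :+ v) :* (con 2 :* (con 15 :+ con 4 :* v) :+ con 3)
                           :+ (con 370 :+ con 196 :* v :+ con 26 :* v :^ 2) := n :+ con 64 :* (con 4 :+ v) :^ 2) refl n v

  D³≤2³⁹Q² : D ^ 3 ≤ 2 ^ 39 * Q ^ 2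
  D³≤2³⁹Q² = begin
    D ^ 3                    ≡⟨ solve 1 (λ w → (con 64 :* w :^ 2) :^ 3 := con 262144 :* (w :^ 3) :^ 2) refl w ⟩
    262144 * (w ^ 3) ^ 2     ≤⟨ *-monoˡ-≤ ((w ^ 3) ^ 2) (≤ᵇ⇒≤ 262144 (2 ^ 39 * 4) _) ⟩
    2 ^ 39 * 4 * (w ^ 3) ^ 2 ≡⟨ rearrange (2 ^ 39) w ⟩
    2 ^ 39 * Q ^ 2           ∎
    where
    open ≤-Reasoning
    -- stated for a variable K, as in WithinBound-intro
    rearrange : ∀ K w → K * 4 * (w ^ 3) ^ 2 ≡ K * (2 * w ^ 3) ^ 2
    rearrange = solve 2 (λ K w → K :* con 4 :* (w :^ 3) :^ 2 := K :* (con 2 :* w :^ 3) :^ 2) refl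

  8wr∸n≤D : 8 * (w * r) ∸ n ≤ D
  8wr∸n≤D = ≤-trans (∸-monoˡ-≤ n 8wr≤n+D) (≤-reflexive (m+n∸m≡n n D))

  1≤Q : 1 ≤ Q
  1≤Q = ≤-witness (127 + 96 * v + 24 * v ^ 2 + 2 * v ^ 3)
    (solve 1 (λ v → con 1 :+ (con 127 :+ con 96 :* v :+ con 24 :* v :^ 2 :+ con 2 :* v :^ 3) := con 2 :* (con 4 :+ v) :^ 3) refl v)

  2Q+2≤n : 2 * Q + 2 ≤ n
  2Q+2≤n = ≤-trans (≤-witness (254 + 192 * v + 48 * v ^ 2 + 4 * v ^ 3)
    (solve 1 (λ v → con 2 :* (con 2 :* (con 4 :+ v) :^ 3) :+ con 2 :+ (con 254 :+ con 192 :* v :+ con 48 :* v :^ 2 :+ con 4 :* v :^ 3)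
                 := con 8 :* (con 4 :+ v) :^ 3) refl v)) n≥

cube-root-≥4 : ∀ {n} → 512 ≤ n → ∃ λ v → 8 * (4 + v) ^ 3 ≤ n × n < 8 * (5 + v) ^ 3
cube-root-≥4 {n} 512≤n with cube-root n
... | k , lo , hi with 4 ≤? k
...   | no 4≰k  = contradiction (<-≤-trans hi (*-monoʳ-≤ 8 (^-monoˡ-≤ 3 (≰⇒> 4≰k)))) (≤⇒≯ 512≤n)
...   | yes 4≤k = k ∸ 4 , subst (λ j → 8 * j ^ 3 ≤ n) (sym k≡) lo , subst (λ j → n < 8 * suc j ^ 3) (sym k≡) hi
  where
  k≡ : 4 + (k ∸ 4) ≡ k
  k≡ = m+[n∸m]≡n 4≤k

admissible : ∀ {n} → 512 ≤ n → Admissible n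
admissible {n} 512≤n with cube-root-≥4 512≤n
... | v , n≥ , n< with odd-multiple-above (15 + 4 * v) (s≤s z≤n) n
...   | u , tm≥ , tm≤ = record
  { w = 4 + v ; u = u ; r = r
  ; r≤t = r≤t ; a≤n = a≤n ; n+2≤2a = n+2≤2a ; n+2≤2[b+r] = n+2≤2[b+r] ; b+b+t<n = b+b+t<n ; b≤4wr = b≤4wr
  ; within = WithinBound-intro n (w * r) D Q 8wr∸n≤D D³≤2³⁹Q² 1≤Q 2Q+2≤n
  }
  where open Choice n v u n≥ n< tm≥ tm≤

corollary5p3 : ∃ λ (N : ℕ) → ∀ (n : ℕ) → n ≥ N →
    Σ (Graph n) λ G → Σ (Colouring n) λ c →
    MinDegreeAtLeastHalfPlusOne G × IsEdgeColouring G c × Proper G c ×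
    BoundedColouring G c ×
    ((H : HamiltonCycle G) → ¬ Rainbow c H)
corollary5p3 = 512 , λ n 512≤n →
  let open Admissible (admissible 512≤n)
      open Construction n w u r
  in graph , colouring , minDegree r≤t a≤n n+2≤2a n+2≤2[b+r] , isEdgeColouring , isProper r≤t ,
     bounded b≤4wr within , noRainbow b+b+t<n
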